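{- Let $G$ be a finite simple graph that is $\{P_4+K_1, P_3\cup K_1\}$-free. Then $\chi(G)\le \frac{3\omega(G)}{2}$.
   Context: $\chi(G)$ is the chromatic number and $\omega(G)$ the clique number. $P_4+K_1$ denotes the join of the path $P_4$ with a single vertex (the gem): a path $p_1p_2p_3p_4$ plus a vertex adjacent to all of $p_1,\dots,p_4$. $P_3\cup K_1$ is the disjoint union of a path on three vertices and an isolated vertex. A graph is $\{H_1,\dots,H_k\}$-free if it has no induced subgraph isomorphic to any $H_i$. -}

module Defs where

open import Data.Nat using (ℕ; zero; suc; _≤_; _*_)
open import Data.Fin using (Fin; zero; suc)
open import Data.Product using (Σ; _×_; _,_)
open import Data.Empty using (⊥)
open import Data.Unit using (⊤)
open import Data.Bool using (Bool; true; false; T)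
open import Data.Bool.Properties using (T?)
open import Relation.Nullary using (¬_; Dec)
open import Relation.Binary.PropositionalEquality using (_≡_; _≢_)
open import Function.Definitions using (Injective)

record Graph (n : ℕ) : Set₁ where
  field
    Adj     : Fin n → Fin n → Set
    adj?    : ∀ u v → Dec (Adj u v)
    sym     : ∀ {u v} → Adj u v → Adj v u
    irrefl  : ∀ {u} → ¬ Adj u u
open Graph public

record InducedSub {m n : ℕ} (H : Graph m) (G : Graph n) : Set where
  field
    f      : Fin m → Fin n
    inj    : Injective _≡_ _≡_ f
    pres   : ∀ u v → Adj H u v → Adj G (f u) (f v)
    refl'  : ∀ u v → Adj G (f u) (f v) → Adj H u v

_-free_ : {m n : ℕ} → Graph n → Graph m → Set
G -free H = ¬ InducedSub H G

-- The gem P4+K1: path 0-1-2-3, vertex 4 adjacent to 0,1,2,3.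
gemB : Fin 5 → Fin 5 → Bool
gemB zero zero = false
gemB zero (suc zero) = true
gemB zero (suc (suc zero)) = false
gemB zero (suc (suc (suc zero))) = false
gemB zero (suc (suc (suc (suc zero)))) = true
gemB (suc zero) zero = true
gemB (suc zero) (suc zero) = false
gemB (suc zero) (suc (suc zero)) = true
gemB (suc zero) (suc (suc (suc zero))) = false
gemB (suc zero) (suc (suc (suc (suc zero)))) = true
gemB (suc (suc zero)) zero = false
gemB (suc (suc zero)) (suc zero) = true
gemB (suc (suc zero)) (suc (suc zero)) = false
gemB (suc (suc zero)) (suc (suc (suc zero))) = true
gemB (suc (suc zero)) (suc (suc (suc (suc zero)))) = true
gemB (suc (suc (suc zero))) zero = false
gemB (suc (suc (suc zero))) (suc zero) = false
gemB (suc (suc (suc zero))) (suc (suc zero)) = true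
gemB (suc (suc (suc zero))) (suc (suc (suc zero))) = false
gemB (suc (suc (suc zero))) (suc (suc (suc (suc zero)))) = true
gemB (suc (suc (suc (suc zero)))) zero = true
gemB (suc (suc (suc (suc zero)))) (suc zero) = true
gemB (suc (suc (suc (suc zero)))) (suc (suc zero)) = true
gemB (suc (suc (suc (suc zero)))) (suc (suc (suc zero))) = true
gemB (suc (suc (suc (suc zero)))) (suc (suc (suc (suc zero)))) = false

gem-sym : ∀ u v → T (gemB u v) → T (gemB v u)
gem-sym zero zero ()
gem-sym zero (suc zero) p = p
gem-sym zero (suc (suc zero)) ()
gem-sym zero (suc (suc (suc zero))) ()
gem-sym zero (suc (suc (suc (suc zero)))) p = p
gem-sym (suc zero) zero p = p
gem-sym (suc zero) (suc zero) ()
gem-sym (suc zero) (suc (suc zero)) p = p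
gem-sym (suc zero) (suc (suc (suc zero))) ()
gem-sym (suc zero) (suc (suc (suc (suc zero)))) p = p
gem-sym (suc (suc zero)) zero ()
gem-sym (suc (suc zero)) (suc zero) p = p
gem-sym (suc (suc zero)) (suc (suc zero)) ()
gem-sym (suc (suc zero)) (suc (suc (suc zero))) p = p
gem-sym (suc (suc zero)) (suc (suc (suc (suc zero)))) p = p
gem-sym (suc (suc (suc zero))) zero ()
gem-sym (suc (suc (suc zero))) (suc zero) ()
gem-sym (suc (suc (suc zero))) (suc (suc zero)) p = p
gem-sym (suc (suc (suc zero))) (suc (suc (suc zero))) ()
gem-sym (suc (suc (suc zero))) (suc (suc (suc (suc zero)))) p = p
gem-sym (suc (suc (suc (suc zero)))) zero p = p
gem-sym (suc (suc (suc (suc zero)))) (suc zero) p = p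
gem-sym (suc (suc (suc (suc zero)))) (suc (suc zero)) p = p
gem-sym (suc (suc (suc (suc zero)))) (suc (suc (suc zero))) p = p
gem-sym (suc (suc (suc (suc zero)))) (suc (suc (suc (suc zero)))) ()
gem-irr : ∀ u → ¬ T (gemB u u)
gem-irr zero ()
gem-irr (suc zero) ()
gem-irr (suc (suc zero)) ()
gem-irr (suc (suc (suc zero))) ()
gem-irr (suc (suc (suc (suc zero)))) ()


gem : Graph 5
gem = record
  { Adj = λ u v → T (gemB u v)
  ; adj? = λ u v → T? (gemB u v)
  ; sym = λ {u} {v} → gem-sym u v
  ; irrefl = λ {u} → gem-irr u
  }

-- P3 ∪ K1: path 0-1-2, vertex 3 isolated.
p3∪k1B : Fin 4 → Fin 4 → Bool
p3∪k1B zero zero = false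
p3∪k1B zero (suc zero) = true
p3∪k1B zero (suc (suc zero)) = false
p3∪k1B zero (suc (suc (suc zero))) = false
p3∪k1B (suc zero) zero = true
p3∪k1B (suc zero) (suc zero) = false
p3∪k1B (suc zero) (suc (suc zero)) = true
p3∪k1B (suc zero) (suc (suc (suc zero))) = false
p3∪k1B (suc (suc zero)) zero = false
p3∪k1B (suc (suc zero)) (suc zero) = true
p3∪k1B (suc (suc zero)) (suc (suc zero)) = false
p3∪k1B (suc (suc zero)) (suc (suc (suc zero))) = false
p3∪k1B (suc (suc (suc zero))) zero = false
p3∪k1B (suc (suc (suc zero))) (suc zero) = false
p3∪k1B (suc (suc (suc zero))) (suc (suc zero)) = false
p3∪k1B (suc (suc (suc zero))) (suc (suc (suc zero))) = false

p3∪k1-sym : ∀ u v → T (p3∪k1B u v) → T (p3∪k1B v u)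
p3∪k1-sym zero zero ()
p3∪k1-sym zero (suc zero) p = p
p3∪k1-sym zero (suc (suc zero)) ()
p3∪k1-sym zero (suc (suc (suc zero))) ()
p3∪k1-sym (suc zero) zero p = p
p3∪k1-sym (suc zero) (suc zero) ()
p3∪k1-sym (suc zero) (suc (suc zero)) p = p
p3∪k1-sym (suc zero) (suc (suc (suc zero))) ()
p3∪k1-sym (suc (suc zero)) zero ()
p3∪k1-sym (suc (suc zero)) (suc zero) p = p
p3∪k1-sym (suc (suc zero)) (suc (suc zero)) ()
p3∪k1-sym (suc (suc zero)) (suc (suc (suc zero))) ()
p3∪k1-sym (suc (suc (suc zero))) zero ()
p3∪k1-sym (suc (suc (suc zero))) (suc zero) ()
p3∪k1-sym (suc (suc (suc zero))) (suc (suc zero)) ()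
p3∪k1-sym (suc (suc (suc zero))) (suc (suc (suc zero))) ()
p3∪k1-irr : ∀ u → ¬ T (p3∪k1B u u)
p3∪k1-irr zero ()
p3∪k1-irr (suc zero) ()
p3∪k1-irr (suc (suc zero)) ()
p3∪k1-irr (suc (suc (suc zero))) ()


p3∪k1 : Graph 4
p3∪k1 = record
  { Adj = λ u v → T (p3∪k1B u v)
  ; adj? = λ u v → T? (p3∪k1B u v)
  ; sym = λ {u} {v} → p3∪k1-sym u v
  ; irrefl = λ {u} → p3∪k1-irr u
  }

record Clique {n : ℕ} (G : Graph n) (k : ℕ) : Set where
  field
    vs   : Fin k → Fin n
    adj  : ∀ i j → i ≢ j → Adj G (vs i) (vs j)

IsCliqueNumber : {n : ℕ} → Graph n → ℕ → Set
IsCliqueNumber G w = Clique G w × (∀ k → Clique G k → k ≤ w)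

record Colouring {n : ℕ} (G : Graph n) (k : ℕ) : Set where
  field
    col    : Fin n → Fin k
    proper : ∀ u v → Adj G u v → col u ≢ col v

IsChromaticNumber : {n : ℕ} → Graph n → ℕ → Set
IsChromaticNumber G c = Colouring G c × (∀ k → Colouring G k → c ≤ k)

{-# OPTIONS --safe #-}
module Submission where

-- By induction on a vertex set S we build a colouring and a clique of G[S] with
-- 2χ ≤ 3ω.  If S contains an independent triple x, y, z then, G being P3 ∪ K1-free,
-- a vertex seeing two of them sees all three; so either the common neighbours of
-- x, y, z are complete to the rest of S, or there are none and the closed
-- neighbourhood of x is anticomplete to the rest of S; either way the bound passes
-- from the two parts to S.  Otherwise α(S) ≤ 2.  An induced pentagon is 3-coloured
-- and, G being gem-free, every other vertex sees exactly three consecutive corners,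
-- so all vertices of a clique outside the pentagon see a common side: removing the
-- pentagon costs 3 colours and 2 clique vertices.  Without pentagons an induced P4
-- abcd covers S by the two cliques N[a] ∩ N[b] and N[c] ∩ N[d]; without P4s two
-- non-adjacent x, y either have common neighbours, complete to the rest of S, or S
-- is covered by the cliques N[y] and S ∖ N[y].  For S covered by two cliques the
-- bound is direct: give one colour to each pair in a maximal set of disjoint
-- non-adjacent pairs across the two cliques.

open import Defs
open import Data.Nat using (ℕ; _≤_; _*_)
open import Data.Nat as ℕ using (_+_; _<_; _⊔_; z≤n; s≤s)
open import Data.Nat.Properties
  using (≤-refl; ≤-trans; ≤-total; <-≤-trans; <⇒≢; m≤m+n; m≤m⊔n; m≤n⊔m; ⊔-lub; +-comm; +-mono-≤;
         +-monoʳ-≤; +-monoʳ-<; +-cancelˡ-≡; *-monoʳ-≤; *-distribˡ-+; *-distribˡ-⊔; module ≤-Reasoning)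
open import Data.Nat.Tactic.RingSolver using (solve-∀)
open import Data.Fin as F using (Fin; zero; suc; splitAt; fromℕ<)
open import Data.Fin.Properties
  using (_≟_; any?; all?; <-cmp; ¬Fin0; splitAt⁻¹-↑ˡ; splitAt⁻¹-↑ʳ; fromℕ<-injective)
open import Data.Fin.Subset as Sub using (Subset; _∈_; _∉_; _⊆_; _⊂_; _∩_; _∪_; _─_)
open import Data.Fin.Subset.Properties
  using (_∈?_; nonempty?; anySubset?; ∉⊥; ∈⊤; x∈⁅x⁆; x∈⁅y⁆⇒x≡y; x∈p∩q⁺; x∈p∩q⁻; x∈p∪q⁺; x∈p∪q⁻;
         p∩q⊆p; p─q⊆p; x∈p∧x∉q⇒x∈p─q; p∩q≢∅⇒p─q⊂p)
open import Data.Fin.Subset.Induction using (⊂-wellFounded)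
open import Data.List using (List; []; _∷_)
open import Data.List.Relation.Unary.All as ListAll using (All; []; _∷_)
open import Data.Product using (_×_; _,_; proj₁; proj₂; ∃)
open import Data.Sum using (_⊎_; inj₁; inj₂; [_,_]; swap)
open import Data.Empty using (⊥; ⊥-elim)
open import Data.Vec using (Vec; []; _∷_; there; tabulate; lookup)
open import Data.Vec.Properties using (lookup∘tabulate; []=⇒lookup; lookup⇒[]=)
open import Function using (_∘_)
open import Induction.WellFounded using (WfRec; module All)
open import Level using (0ℓ)
open import Relation.Binary.Definitions using (tri<; tri≈; tri>)
open import Relation.Binary.PropositionalEquality
  using (_≡_; _≢_; refl; cong; subst; subst₂; trans; ≢-sym) renaming (sym to ≡-sym)
open import Relation.Nullary using (¬_; Dec; yes; no; does; ¬?)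
open import Relation.Nullary.Decidable
  using (_×-dec_; _⊎-dec_; _→-dec_; dec-true; decidable-stable; from-yes; from-no)
open import Relation.Unary using (Pred; Decidable)

-- Opaque: unfolding the tabulated vector makes unification with membership proofs explode.
opaque
  select : ∀ {m} {P : Pred (Fin m) 0ℓ} → Decidable P → Subset m
  select P? = tabulate (does ∘ P?)

  ∈-select⁺ : ∀ {m} {P : Pred (Fin m) 0ℓ} (P? : Decidable P) {x} → P x → x ∈ select P?
  ∈-select⁺ P? {x} px = lookup⇒[]= x _ (trans (lookup∘tabulate _ x) (dec-true (P? x) px))

  ∈-select⁻ : ∀ {m} {P : Pred (Fin m) 0ℓ} (P? : Decidable P) {x} → x ∈ select P? → P x
  ∈-select⁻ P? {x} x∈ with P? x | trans (≡-sym (lookup∘tabulate (does ∘ P?) x)) ([]=⇒lookup x∈)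
  ... | yes px | _ = px

x∈p─q⇒x∉q : ∀ {m} (p q : Subset m) {x} → x ∈ p ─ q → x ∉ q
x∈p─q⇒x∉q (_ ∷ p) (_ ∷ q) (there x∈) (there x∈q) = x∈p─q⇒x∉q p q x∈ x∈q

x∈p─p∩q⁻ : ∀ {m} (p q : Subset m) {x} → x ∈ p ─ (p ∩ q) → x ∈ p × x ∉ q
x∈p─p∩q⁻ p q x∈ = p─q⊆p p (p ∩ q) x∈ , λ x∈q → x∈p─q⇒x∉q p (p ∩ q) x∈ (x∈p∩q⁺ (p─q⊆p p (p ∩ q) x∈ , x∈q))

∩-monoˡ : ∀ {m} {p q r : Subset m} → p ⊆ q → p ∩ r ⊆ q ∩ r
∩-monoˡ {p = p} {r = r} p⊆q x∈p∩r = x∈p∩q⁺ (p⊆q (proj₁ (x∈p∩q⁻ p r x∈p∩r)) , proj₂ (x∈p∩q⁻ p r x∈p∩r))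

pair : ∀ {m} → Fin m → Fin m → Subset m
pair x y = select (λ z → (z ≟ x) ⊎-dec (z ≟ y))

∈-pair⁻ : ∀ {m} {x y z : Fin m} → z ∈ pair x y → z ≡ x ⊎ z ≡ y
∈-pair⁻ {x = x} {y} = ∈-select⁻ (λ z → (z ≟ x) ⊎-dec (z ≟ y))

x∈pair : ∀ {m} (x y : Fin m) → x ∈ pair x y
x∈pair x y = ∈-select⁺ (λ z → (z ≟ x) ⊎-dec (z ≟ y)) (inj₁ refl)

y∈pair : ∀ {m} (x y : Fin m) → y ∈ pair x y
y∈pair x y = ∈-select⁺ (λ z → (z ≟ x) ⊎-dec (z ≟ y)) (inj₂ refl)

x∈p∧x∉q⇒p∩q⊂p : ∀ {m} {p q : Subset m} {x} → x ∈ p → x ∉ q → p ∩ q ⊂ p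
x∈p∧x∉q⇒p∩q⊂p {p = p} {q} x∈p x∉q = p∩q⊆p p q , _ , x∈p , x∉q ∘ proj₂ ∘ x∈p∩q⁻ p q

x∈p∧x∈q⇒p─p∩q⊂p : ∀ {m} {p q : Subset m} {x} → x ∈ p → x ∈ q → p ─ (p ∩ q) ⊂ p
x∈p∧x∈q⇒p─p∩q⊂p {p = p} {q} x∈p x∈q = p∩q≢∅⇒p─q⊂p p (p ∩ q) (_ , x∈p∩q⁺ (x∈p , x∈p∩q⁺ (x∈p , x∈q)))

next : Fin 5 → Fin 5
next zero                         = suc zero
next (suc zero)                   = suc (suc zero)
next (suc (suc zero))             = suc (suc (suc zero))
next (suc (suc (suc zero)))       = suc (suc (suc (suc zero)))
next (suc (suc (suc (suc zero)))) = zero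

infixl 6 _⊕_
_⊕_ : Fin 5 → ℕ → Fin 5
i ⊕ ℕ.zero  = i
i ⊕ ℕ.suc k = next (i ⊕ k)

⊕-5 : ∀ i → i ⊕ 5 ≡ i
⊕-5 = from-yes (all? λ i → i ⊕ 5 ≟ i)

WindowAt : Subset 5 → Fin 5 → Set
WindowAt N m = m ∈ N × m ⊕ 1 ∈ N × m ⊕ 2 ∈ N × m ⊕ 3 ∉ N × m ⊕ 4 ∉ N

-- Facts about sets of positions on a pentagon, checked by evaluation over all
-- subsets of Fin 5; opaque so that the decision procedures are never unfolded.
opaque
  window-pattern : ∀ N → (∀ i → i ∈ N ⊎ i ⊕ 2 ∈ N) →
                   (∀ i → ¬ (i ∈ N × i ⊕ 1 ∈ N × i ⊕ 2 ∈ N × i ⊕ 3 ∈ N)) → ∃ (WindowAt N)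
  window-pattern N covers no-four = decidable-stable (window? N) λ no-window →
    from-no (anySubset? λ N → covers? N ×-dec no-four? N ×-dec ¬? (window? N))
            (N , covers , no-four , no-window)
    where
    window? : ∀ N → Dec (∃ (WindowAt N))
    window? N = any? λ m →
      m ∈? N ×-dec m ⊕ 1 ∈? N ×-dec m ⊕ 2 ∈? N ×-dec ¬? (m ⊕ 3 ∈? N) ×-dec ¬? (m ⊕ 4 ∈? N)
    covers? : ∀ N → Dec (∀ i → i ∈ N ⊎ i ⊕ 2 ∈ N)
    covers? N = all? λ i → i ∈? N ⊎-dec i ⊕ 2 ∈? N
    no-four? : ∀ N → Dec (∀ i → ¬ (i ∈ N × i ⊕ 1 ∈ N × i ⊕ 2 ∈ N × i ⊕ 3 ∈ N))
    no-four? N = all? λ i → ¬? (i ∈? N ×-dec i ⊕ 1 ∈? N ×-dec i ⊕ 2 ∈? N ×-dec i ⊕ 3 ∈? N)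

  two-consecutive-positions : ∀ M → (∀ a b → a ∈ M → b ∈ M → b ≢ a ⊕ 2) →
                              ∃ λ j → ∀ a → a ∈ M → a ≡ j ⊎ a ≡ j ⊕ 1
  two-consecutive-positions M spread = decidable-stable (consecutive? M) λ not-consecutive →
    from-no (anySubset? λ M → spread? M ×-dec ¬? (consecutive? M)) (M , spread , not-consecutive)
    where
    consecutive? : ∀ M → Dec (∃ λ j → ∀ a → a ∈ M → a ≡ j ⊎ a ≡ j ⊕ 1)
    consecutive? M = any? λ j → all? λ a → a ∈? M →-dec (a ≟ j ⊎-dec a ≟ j ⊕ 1)
    spread? : ∀ M → Dec (∀ a b → a ∈ M → b ∈ M → b ≢ a ⊕ 2)
    spread? M = all? λ a → all? λ b → a ∈? M →-dec b ∈? M →-dec ¬? (b ≟ a ⊕ 2)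

module _ {n : ℕ} (G : Graph n) where

  open Graph G using () renaming (Adj to _~_; adj? to _~?_; sym to ~-sym; irrefl to ~-irrefl)

  _≁_ : Fin n → Fin n → Set
  u ≁ v = ¬ u ~ v

  ~⇒≢ : ∀ {u v} → u ~ v → u ≢ v
  ~⇒≢ u~v refl = ~-irrefl u~v

  ≢-by-neighbour : ∀ {u v w} → u ≁ w → v ~ w → u ≢ v
  ≢-by-neighbour u≁w v~w refl = u≁w v~w

  Apart : Fin n → Fin n → Set
  Apart x y = x ≢ y × x ≁ y

  Apart-sym : ∀ {x y} → Apart x y → Apart y x
  Apart-sym (x≢y , x≁y) = ≢-sym x≢y , x≁y ∘ ~-sym

  apart-by-neighbour : ∀ {a c u} → u ~ a → c ≁ a → u ≁ c → Apart u c
  apart-by-neighbour u~a c≁a u≁c = ≢-sym (≢-by-neighbour c≁a u~a) , u≁c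

  -- Colourings and cliques of vertex sets

  record CliqueIn (S : Subset n) (k : ℕ) : Set where
    field
      vertex   : Fin k → Fin n
      vertex∈  : ∀ i → vertex i ∈ S
      adjacent : ∀ {i j} → i ≢ j → vertex i ~ vertex j
  open CliqueIn

  -- Colours are natural numbers below k, not elements of Fin k, so that palettes can be
  -- shifted and merged.
  record ColouringOn (S : Subset n) (k : ℕ) : Set where
    field
      colour  : Fin n → ℕ
      colour< : ∀ {v} → v ∈ S → colour v < k
      proper  : ∀ {u v} → u ∈ S → v ∈ S → u ~ v → colour u ≢ colour v
  open ColouringOn

  record ThreeHalvesBound (S : Subset n) : Set where
    field
      colours size : ℕ
      colouring    : ColouringOn S colours
      clique       : CliqueIn S size
      2χ≤3ω        : 2 * colours ≤ 3 * size
  open ThreeHalvesBound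

  clique-mono : ∀ {S T k} → S ⊆ T → CliqueIn S k → CliqueIn T k
  clique-mono S⊆T K = record { vertex = vertex K ; vertex∈ = S⊆T ∘ vertex∈ K ; adjacent = adjacent K }

  clique-empty : ∀ {S} → CliqueIn S 0
  clique-empty = record { vertex = λ () ; vertex∈ = λ () ; adjacent = λ {i} → ⊥-elim (¬Fin0 i) }

  clique-single : ∀ {S v} → v ∈ S → CliqueIn S 1
  clique-single {v = v} v∈S = record
    { vertex = λ _ → v ; vertex∈ = λ _ → v∈S ; adjacent = λ { {zero} {zero} 0≢0 → ⊥-elim (0≢0 refl) } }

  clique-join : ∀ {S a b} (K : CliqueIn S a) (L : CliqueIn S b) →
                (∀ i j → vertex K i ~ vertex L j) → CliqueIn S (a + b)
  clique-join {S} {a} {b} K L K~L = record { vertex = vtx ; vertex∈ = vtx∈ ; adjacent = adj }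
    where
    vtx : Fin (a + b) → Fin n
    vtx i = [ vertex K , vertex L ] (splitAt a i)
    vtx∈ : ∀ i → vtx i ∈ S
    vtx∈ i with splitAt a i
    ... | inj₁ x = vertex∈ K x
    ... | inj₂ y = vertex∈ L y
    adj : ∀ {i j} → i ≢ j → vtx i ~ vtx j
    adj {i} {j} i≢j with splitAt a i in eqi | splitAt a j in eqj
    ... | inj₁ x | inj₁ y = adjacent K λ { refl → i≢j (trans (≡-sym (splitAt⁻¹-↑ˡ eqi)) (splitAt⁻¹-↑ˡ eqj)) }
    ... | inj₁ x | inj₂ y = K~L x y
    ... | inj₂ x | inj₁ y = ~-sym (K~L y x)
    ... | inj₂ x | inj₂ y = adjacent L λ { refl → i≢j (trans (≡-sym (splitAt⁻¹-↑ʳ eqi)) (splitAt⁻¹-↑ʳ eqj)) }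

  colouring-mono : ∀ {S T k} → T ⊆ S → ColouringOn S k → ColouringOn T k
  colouring-mono T⊆S C = record
    { colour = colour C ; colour< = colour< C ∘ T⊆S ; proper = λ u∈ v∈ → proper C (T⊆S u∈) (T⊆S v∈) }

  independent-colouring : ∀ {S} → (∀ {u v} → u ∈ S → v ∈ S → u ≁ v) → ColouringOn S 1
  independent-colouring indep = record
    { colour = λ _ → 0 ; colour< = λ _ → s≤s z≤n ; proper = λ u∈ v∈ u~v _ → indep u∈ v∈ u~v }

  colouring-+ : ∀ {S X t k} → ColouringOn X t → ColouringOn (S ─ X) k → ColouringOn S (t + k)
  colouring-+ {S} {X} {t} {k} CX CR = record { colour = col ; colour< = col< ; proper = prop }
    where
    col : Fin n → ℕ
    col v with v ∈? X
    ... | yes _ = colour CX v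
    ... | no _  = t + colour CR v
    col< : ∀ {v} → v ∈ S → col v < t + k
    col< {v} v∈S with v ∈? X
    ... | yes v∈X = <-≤-trans (colour< CX v∈X) (m≤m+n t k)
    ... | no v∉X  = +-monoʳ-< t (colour< CR (x∈p∧x∉q⇒x∈p─q v∈S v∉X))
    prop : ∀ {u v} → u ∈ S → v ∈ S → u ~ v → col u ≢ col v
    prop {u} {v} u∈S v∈S u~v with u ∈? X | v ∈? X
    ... | yes u∈X | yes v∈X = proper CX u∈X v∈X u~v
    ... | yes u∈X | no _    = <⇒≢ (<-≤-trans (colour< CX u∈X) (m≤m+n t _))
    ... | no _    | yes v∈X = ≢-sym (<⇒≢ (<-≤-trans (colour< CX v∈X) (m≤m+n t _)))
    ... | no u∉X  | no v∉X  = proper CR (x∈p∧x∉q⇒x∈p─q u∈S u∉X) (x∈p∧x∉q⇒x∈p─q v∈S v∉X) u~v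
                              ∘ +-cancelˡ-≡ t _ _

  colouring-⊔ : ∀ {S A k l} → (∀ {u v} → u ∈ A → v ∈ S ─ A → u ≁ v) →
                ColouringOn A k → ColouringOn (S ─ A) l → ColouringOn S (k ⊔ l)
  colouring-⊔ {S} {A} {k} {l} A≁R CA CR = record { colour = col ; colour< = col< ; proper = prop }
    where
    col : Fin n → ℕ
    col v with v ∈? A
    ... | yes _ = colour CA v
    ... | no _  = colour CR v
    col< : ∀ {v} → v ∈ S → col v < k ⊔ l
    col< {v} v∈S with v ∈? A
    ... | yes v∈A = <-≤-trans (colour< CA v∈A) (m≤m⊔n k l)
    ... | no v∉A  = <-≤-trans (colour< CR (x∈p∧x∉q⇒x∈p─q v∈S v∉A)) (m≤n⊔m k l)
    prop : ∀ {u v} → u ∈ S → v ∈ S → u ~ v → col u ≢ col v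
    prop {u} {v} u∈S v∈S u~v with u ∈? A | v ∈? A
    ... | yes u∈A | yes v∈A = proper CA u∈A v∈A u~v
    ... | yes u∈A | no v∉A  = ⊥-elim (A≁R u∈A (x∈p∧x∉q⇒x∈p─q v∈S v∉A) u~v)
    ... | no u∉A  | yes v∈A = ⊥-elim (A≁R v∈A (x∈p∧x∉q⇒x∈p─q u∈S u∉A) (~-sym u~v))
    ... | no u∉A  | no v∉A  = proper CR (x∈p∧x∉q⇒x∈p─q u∈S u∉A) (x∈p∧x∉q⇒x∈p─q v∈S v∉A) u~v

  colouring-∪ : ∀ {X Y t k} → ColouringOn X t → ColouringOn Y k → ColouringOn (X ∪ Y) (t + k)
  colouring-∪ {X} {Y} CX CY = colouring-+ CX (colouring-mono rest⊆Y CY)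
    where
    rest⊆Y : (X ∪ Y) ─ X ⊆ Y
    rest⊆Y x∈ with x∈p∪q⁻ X Y (p─q⊆p (X ∪ Y) X x∈)
    ... | inj₁ x∈X = ⊥-elim (x∈p─q⇒x∉q (X ∪ Y) X x∈ x∈X)
    ... | inj₂ x∈Y = x∈Y

  bound-by-removal : ∀ {S X t s} → ColouringOn X t → 2 * t ≤ 3 * s →
                     (∀ {w} → CliqueIn (S ─ X) w → CliqueIn S (s + w)) →
                     ThreeHalvesBound (S ─ X) → ThreeHalvesBound S
  bound-by-removal {t = t} {s} CX 2t≤3s extend B = record
    { colours = t + colours B ; size = s + size B
    ; colouring = colouring-+ CX (colouring B) ; clique = extend (clique B)
    ; 2χ≤3ω = subst₂ _≤_ (≡-sym (*-distribˡ-+ 2 t (colours B))) (≡-sym (*-distribˡ-+ 3 s (size B)))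
                (+-mono-≤ 2t≤3s (2χ≤3ω B)) }

  join-bound : ∀ {S A} → A ⊆ S → (∀ {u v} → u ∈ A → v ∈ S ─ A → u ~ v) →
               ThreeHalvesBound A → ThreeHalvesBound (S ─ A) → ThreeHalvesBound S
  join-bound {S} {A} A⊆S A~R BA = bound-by-removal (colouring BA) (2χ≤3ω BA) extend
    where
    extend : ∀ {w} → CliqueIn (S ─ A) w → CliqueIn S (size BA + w)
    extend K = clique-join (clique-mono A⊆S (clique BA)) (clique-mono (p─q⊆p S A) K)
                 (λ i j → A~R (vertex∈ (clique BA) i) (vertex∈ K j))

  disjoint-union-bound : ∀ {S A} → A ⊆ S → (∀ {u v} → u ∈ A → v ∈ S ─ A → u ≁ v) →
                         ThreeHalvesBound A → ThreeHalvesBound (S ─ A) → ThreeHalvesBound S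
  disjoint-union-bound {S} {A} A⊆S A≁R BA BR with ≤-total (size BA) (size BR)
  ... | inj₁ ωA≤ωR = record
    { colours = colours BA ⊔ colours BR ; size = size BR
    ; colouring = colouring-⊔ A≁R (colouring BA) (colouring BR)
    ; clique = clique-mono (p─q⊆p S A) (clique BR)
    ; 2χ≤3ω = subst (_≤ 3 * size BR) (≡-sym (*-distribˡ-⊔ 2 (colours BA) (colours BR)))
                (⊔-lub (≤-trans (2χ≤3ω BA) (*-monoʳ-≤ 3 ωA≤ωR)) (2χ≤3ω BR)) }
  ... | inj₂ ωR≤ωA = record
    { colours = colours BA ⊔ colours BR ; size = size BA
    ; colouring = colouring-⊔ A≁R (colouring BA) (colouring BR)
    ; clique = clique-mono A⊆S (clique BA)
    ; 2χ≤3ω = subst (_≤ 3 * size BA) (≡-sym (*-distribˡ-⊔ 2 (colours BA) (colours BR)))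
                (⊔-lub (2χ≤3ω BA) (≤-trans (2χ≤3ω BR) (*-monoʳ-≤ 3 ωR≤ωA))) }

  -- Vertex sets covered by two cliques

  PairwiseAdjacent : Subset n → Set
  PairwiseAdjacent A = ∀ {u v} → u ∈ A → v ∈ A → u ≢ v → u ~ v

  larger-clique : ∀ {S a b} → CliqueIn S a → CliqueIn S b → ∃ λ m → CliqueIn S m × a ≤ m × b ≤ m
  larger-clique {a = a} {b} K L with ≤-total a b
  ... | inj₁ a≤b = b , L , a≤b , ≤-refl
  ... | inj₂ b≤a = a , K , ≤-refl , b≤a

  -- The invariant of a greedy pairing of non-adjacent vertices a ∈ A, b ∈ B: each pair uses
  -- one colour and enlarges both side cliques, each unpaired vertex enlarges the clique of S.
  record CoBipartiteWitness (A B S : Subset n) : Set where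
    field
      colours a b u : ℕ
      colouring     : ColouringOn S colours
      clique-A      : CliqueIn (S ∩ A) a
      clique-B      : CliqueIn (S ∩ B) b
      clique-S      : CliqueIn S u
      2χ≤a+b+u      : 2 * colours ≤ a + b + u
  open CoBipartiteWitness

  witness-swap : ∀ {A B S} → CoBipartiteWitness A B S → CoBipartiteWitness B A S
  witness-swap W = record
    { colours = colours W ; a = b W ; b = a W ; u = u W
    ; colouring = colouring W ; clique-A = clique-B W ; clique-B = clique-A W ; clique-S = clique-S W
    ; 2χ≤a+b+u = subst (λ m → 2 * colours W ≤ m + u W) (+-comm (a W) (b W)) (2χ≤a+b+u W) }

  witness-empty : ∀ {A B S} → ¬ Sub.Nonempty S → CoBipartiteWitness A B S
  witness-empty S=∅ = record
    { colours = 0 ; a = 0 ; b = 0 ; u = 0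
    ; colouring = record { colour = λ _ → 0 ; colour< = λ v∈S → ⊥-elim (S=∅ (_ , v∈S))
                         ; proper = λ u∈S _ _ → ⊥-elim (S=∅ (_ , u∈S)) }
    ; clique-A = clique-empty ; clique-B = clique-empty ; clique-S = clique-empty ; 2χ≤a+b+u = z≤n }

  witness-bound : ∀ {A B S} → CoBipartiteWitness A B S → ThreeHalvesBound S
  witness-bound {A} {B} {S} W
    with larger-clique (clique-mono (p∩q⊆p S A) (clique-A W)) (clique-mono (p∩q⊆p S B) (clique-B W))
  ... | m , K , a≤m , b≤m with larger-clique K (clique-S W)
  ...   | m′ , K′ , m≤m′ , u≤m′ = record
    { colours = colours W ; size = m′ ; colouring = colouring W ; clique = K′
    ; 2χ≤3ω = ≤-trans (2χ≤a+b+u W) (subst (a W + b W + u W ≤_) (three-times m′)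
                 (+-mono-≤ (+-mono-≤ (≤-trans a≤m m≤m′) (≤-trans b≤m m≤m′)) u≤m′)) }
    where
    three-times : ∀ m → m + m + m ≡ 3 * m
    three-times = solve-∀

  clique-cons : ∀ {S X A k v} → PairwiseAdjacent A → v ∈ S → v ∈ A → v ∈ X →
                CliqueIn ((S ─ X) ∩ A) k → CliqueIn (S ∩ A) (1 + k)
  clique-cons {S} {X} {A} A-adj v∈S v∈A v∈X K =
    clique-join (clique-single (x∈p∩q⁺ (v∈S , v∈A))) (clique-mono (∩-monoˡ (p─q⊆p S X)) K) v~K
    where
    v~K : ∀ i j → _ ~ vertex K j
    v~K _ j with x∈p∩q⁻ (S ─ X) A (vertex∈ K j)
    ... | x∈S─X , x∈A = A-adj v∈A x∈A λ { refl → x∈p─q⇒x∉q S X x∈S─X v∈X }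

  pair-colouring : ∀ {x y} → x ≁ y → ColouringOn (pair x y) 1
  pair-colouring {x} {y} x≁y = independent-colouring indep
    where
    indep : ∀ {u v} → u ∈ pair x y → v ∈ pair x y → u ≁ v
    indep u∈ v∈ with ∈-pair⁻ u∈ | ∈-pair⁻ v∈
    ... | inj₁ refl | inj₁ refl = ~-irrefl
    ... | inj₁ refl | inj₂ refl = x≁y
    ... | inj₂ refl | inj₁ refl = x≁y ∘ ~-sym
    ... | inj₂ refl | inj₂ refl = ~-irrefl

  single-colouring : ∀ x → ColouringOn Sub.⁅ x ⁆ 1
  single-colouring x = independent-colouring λ u∈ v∈ →
    subst₂ _≁_ (≡-sym (x∈⁅y⁆⇒x≡y x u∈)) (≡-sym (x∈⁅y⁆⇒x≡y x v∈)) ~-irrefl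

  one-more-colour : ∀ {k s} → 2 * k ≤ s → 2 * (1 + k) ≤ 2 + s
  one-more-colour {k} {s} 2k≤s = subst (_≤ 2 + s) (≡-sym (*-distribˡ-+ 2 1 k)) (+-monoʳ-≤ 2 2k≤s)

  witness-step : ∀ {A B S v} → PairwiseAdjacent A → PairwiseAdjacent B →
                 (∀ {x} → x ∈ S → x ∈ A ⊎ x ∈ B) → v ∈ S → v ∈ A →
                 (∀ {S′} → S′ ⊂ S → CoBipartiteWitness A B S′) → CoBipartiteWitness A B S
  witness-step {A} {B} {S} {v} A-adj B-adj cover v∈S v∈A rec
    with any? (λ y → y ∈? S ×-dec y ∈? B ×-dec ¬? (y ≟ v) ×-dec ¬? (v ~? y))
  ... | yes (y , y∈S , y∈B , y≢v , v≁y) = record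
    { colours = 1 + colours W ; a = 1 + a W ; b = 1 + b W ; u = u W
    ; colouring = colouring-+ (pair-colouring v≁y) (colouring W)
    ; clique-A = clique-cons A-adj v∈S v∈A (x∈pair v y) (clique-A W)
    ; clique-B = clique-cons B-adj y∈S y∈B (y∈pair v y) (clique-B W)
    ; clique-S = clique-mono (p─q⊆p S _) (clique-S W)
    ; 2χ≤a+b+u = subst (2 * (1 + colours W) ≤_) (rearrange (a W) (b W) (u W))
                   (one-more-colour (2χ≤a+b+u W)) }
    where
    W = rec (p∩q≢∅⇒p─q⊂p S (pair v y) (v , x∈p∩q⁺ (v∈S , x∈pair v y)))
    rearrange : ∀ a b u → 2 + (a + b + u) ≡ (1 + a) + (1 + b) + u
    rearrange = solve-∀
  ... | no no-non-neighbour = record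
    { colours = 1 + colours W ; a = 1 + a W ; b = b W ; u = 1 + u W
    ; colouring = colouring-+ (single-colouring v) (colouring W)
    ; clique-A = clique-cons A-adj v∈S v∈A (x∈⁅x⁆ v) (clique-A W)
    ; clique-B = clique-mono (∩-monoˡ (p─q⊆p S _)) (clique-B W)
    ; clique-S = clique-join (clique-single v∈S) (clique-mono (p─q⊆p S _) (clique-S W))
                   (λ _ j → v~rest (vertex∈ (clique-S W) j))
    ; 2χ≤a+b+u = subst (2 * (1 + colours W) ≤_) (rearrange (a W) (b W) (u W))
                   (one-more-colour (2χ≤a+b+u W)) }
    where
    W = rec (p∩q≢∅⇒p─q⊂p S Sub.⁅ v ⁆ (v , x∈p∩q⁺ (v∈S , x∈⁅x⁆ v)))
    v~rest : ∀ {x} → x ∈ S ─ Sub.⁅ v ⁆ → v ~ x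
    v~rest {x} x∈ with cover (p─q⊆p S _ x∈) | v ~? x
    ... | _        | yes v~x = v~x
    ... | inj₁ x∈A | no _    = A-adj v∈A x∈A (λ { refl → x∈p─q⇒x∉q S _ x∈ (x∈⁅x⁆ v) })
    ... | inj₂ x∈B | no v≁x  = ⊥-elim (no-non-neighbour
                                 (x , p─q⊆p S _ x∈ , x∈B , (λ { refl → x∈p─q⇒x∉q S _ x∈ (x∈⁅x⁆ v) }) , v≁x))
    rearrange : ∀ a b u → 2 + (a + b + u) ≡ (1 + a) + b + (1 + u)
    rearrange = solve-∀

  co-bipartite-bound : ∀ {A B} → PairwiseAdjacent A → PairwiseAdjacent B →
                       ∀ S → (∀ {x} → x ∈ S → x ∈ A ⊎ x ∈ B) → ThreeHalvesBound S
  co-bipartite-bound {A} {B} A-adj B-adj S cover =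
    witness-bound (All.wfRec ⊂-wellFounded _ Covered step S cover)
    where
    Covered : Subset n → Set
    Covered S = (∀ {x} → x ∈ S → x ∈ A ⊎ x ∈ B) → CoBipartiteWitness A B S
    step : ∀ S → WfRec _⊂_ Covered S → Covered S
    step S rec cover with nonempty? S
    ... | no S=∅ = witness-empty S=∅
    ... | yes (v , v∈S) with cover v∈S
    ...   | inj₁ v∈A = witness-step A-adj B-adj cover v∈S v∈A rec′
      where
      rec′ : ∀ {S′} → S′ ⊂ S → CoBipartiteWitness A B S′
      rec′ S′⊂S = rec S′⊂S (cover ∘ proj₁ S′⊂S)
    ...   | inj₂ v∈B = witness-swap (witness-step B-adj A-adj (swap ∘ cover) v∈S v∈B rec′)
      where
      rec′ : ∀ {S′} → S′ ⊂ S → CoBipartiteWitness B A S′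
      rec′ S′⊂S = witness-swap (rec S′⊂S (cover ∘ proj₁ S′⊂S))

  -- Forbidden induced subgraphs

  Agrees : ∀ {P : Set} → Dec P → Fin n → Fin n → Set
  Agrees (yes _) x y = x ~ y
  Agrees (no _)  x y = Apart x y

  -- Only the pairs i < j have to be checked: the rest follows by symmetry and irreflexivity.
  induced-copy : ∀ {m} (H : Graph m) (f : Fin m → Fin n) →
                 (∀ {i j} → i F.< j → Agrees (Graph.adj? H i j) (f i) (f j)) → InducedSub H G
  induced-copy H f agree = record { f = f ; inj = inj ; pres = pres ; refl' = reflect }
    where
    agree< : ∀ {i j} → i F.< j → (Adj H i j → f i ~ f j) × (f i ~ f j → Adj H i j) × f i ≢ f j
    agree< {i} {j} i<j with Graph.adj? H i j | agree i<j
    ... | yes a | fi~fj         = (λ _ → fi~fj) , (λ _ → a) , ~⇒≢ fi~fj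
    ... | no ¬a | fi≢fj , fi≁fj = (λ a → ⊥-elim (¬a a)) , (λ fi~fj → ⊥-elim (fi≁fj fi~fj)) , fi≢fj
    inj : ∀ {i j} → f i ≡ f j → i ≡ j
    inj {i} {j} eq with <-cmp i j
    ... | tri< i<j _ _ = ⊥-elim (proj₂ (proj₂ (agree< i<j)) eq)
    ... | tri≈ _ i≡j _ = i≡j
    ... | tri> _ _ j<i = ⊥-elim (proj₂ (proj₂ (agree< j<i)) (≡-sym eq))
    pres : ∀ i j → Adj H i j → f i ~ f j
    pres i j a with <-cmp i j
    ... | tri< i<j _ _  = proj₁ (agree< i<j) a
    ... | tri≈ _ refl _ = ⊥-elim (Graph.irrefl H a)
    ... | tri> _ _ j<i  = ~-sym (proj₁ (agree< j<i) (Graph.sym H a))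
    reflect : ∀ i j → f i ~ f j → Adj H i j
    reflect i j fi~fj with <-cmp i j
    ... | tri< i<j _ _  = proj₁ (proj₂ (agree< i<j)) fi~fj
    ... | tri≈ _ refl _ = ⊥-elim (~-irrefl fi~fj)
    ... | tri> _ _ j<i  = Graph.sym H (proj₁ (proj₂ (agree< j<i)) (~-sym fi~fj))

  record InducedP4 (a b c d : Fin n) : Set where
    constructor induced-P4
    field
      a~b : a ~ b
      b~c : b ~ c
      c~d : c ~ d
      a≁c : a ≁ c
      a≁d : a ≁ d
      b≁d : b ≁ d

    a⊥c : Apart a c
    a⊥c = ≢-by-neighbour a≁d c~d , a≁c

    a⊥d : Apart a d
    a⊥d = apart-by-neighbour a~b (b≁d ∘ ~-sym) a≁d

    b⊥d : Apart b d
    b⊥d = apart-by-neighbour (~-sym a~b) (a≁d ∘ ~-sym) b≁d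

  reverse : ∀ {a b c d} → InducedP4 a b c d → InducedP4 d c b a
  reverse P = record
    { a~b = ~-sym c~d ; b~c = ~-sym b~c ; c~d = ~-sym a~b
    ; a≁c = b≁d ∘ ~-sym ; a≁d = a≁d ∘ ~-sym ; b≁d = a≁c ∘ ~-sym }
    where open InducedP4 P

  no-dominated-P4 : G -free gem → ∀ {a b c d e} → InducedP4 a b c d → e ~ a → e ~ b → e ~ c → e ~ d → ⊥
  no-dominated-P4 gem-free {a} {b} {c} {d} {e} P e~a e~b e~c e~d = gem-free (induced-copy gem f agree)
    where
    open InducedP4 P
    f : Fin 5 → Fin n
    f = lookup (a ∷ b ∷ c ∷ d ∷ e ∷ [])
    agree : ∀ {i j} → i F.< j → Agrees (Graph.adj? gem i j) (f i) (f j)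
    agree {_}                       {zero} ()
    agree {zero}                    {suc zero} _ = a~b
    agree {suc _}                   {suc zero} (s≤s ())
    agree {zero}                    {suc (suc zero)} _ = a⊥c
    agree {suc zero}                {suc (suc zero)} _ = b~c
    agree {suc (suc _)}             {suc (suc zero)} (s≤s (s≤s ()))
    agree {zero}                    {suc (suc (suc zero))} _ = a⊥d
    agree {suc zero}                {suc (suc (suc zero))} _ = b⊥d
    agree {suc (suc zero)}          {suc (suc (suc zero))} _ = c~d
    agree {suc (suc (suc _))}       {suc (suc (suc zero))} (s≤s (s≤s (s≤s ())))
    agree {zero}                    {suc (suc (suc (suc zero)))} _ = ~-sym e~a
    agree {suc zero}                {suc (suc (suc (suc zero)))} _ = ~-sym e~b
    agree {suc (suc zero)}          {suc (suc (suc (suc zero)))} _ = ~-sym e~c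
    agree {suc (suc (suc zero))}    {suc (suc (suc (suc zero)))} _ = ~-sym e~d
    agree {suc (suc (suc (suc _)))} {suc (suc (suc (suc zero)))} (s≤s (s≤s (s≤s (s≤s ()))))

  no-isolated-P3 : G -free p3∪k1 → ∀ {a b c d} → a ~ b → b ~ c → Apart a c → d ≁ a → d ≁ b → d ≁ c → ⊥
  no-isolated-P3 p3∪k1-free {a} {b} {c} {d} a~b b~c a⊥c d≁a d≁b d≁c = p3∪k1-free (induced-copy p3∪k1 f agree)
    where
    f : Fin 4 → Fin n
    f = lookup (a ∷ b ∷ c ∷ d ∷ [])
    agree : ∀ {i j} → i F.< j → Agrees (Graph.adj? p3∪k1 i j) (f i) (f j)
    agree {_}                 {zero} ()
    agree {zero}              {suc zero} _ = a~b
    agree {suc _}             {suc zero} (s≤s ())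
    agree {zero}              {suc (suc zero)} _ = a⊥c
    agree {suc zero}          {suc (suc zero)} _ = b~c
    agree {suc (suc _)}       {suc (suc zero)} (s≤s (s≤s ()))
    agree {zero}              {suc (suc (suc zero))} _ = apart-by-neighbour a~b d≁b (d≁a ∘ ~-sym)
    agree {suc zero}          {suc (suc (suc zero))} _ = apart-by-neighbour (~-sym a~b) d≁a (d≁b ∘ ~-sym)
    agree {suc (suc zero)}    {suc (suc (suc zero))} _ = apart-by-neighbour (~-sym b~c) d≁b (d≁c ∘ ~-sym)
    agree {suc (suc (suc _))} {suc (suc (suc zero))} (s≤s (s≤s (s≤s ())))

  -- Independent triples

  record IndependentTriple (x y z : Fin n) : Set where
    constructor independent
    field
      x⊥y : Apart x y
      x⊥z : Apart x z
      y⊥z : Apart y z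

  rotate : ∀ {x y z} → IndependentTriple x y z → IndependentTriple y z x
  rotate (independent x⊥y x⊥z y⊥z) = independent y⊥z (Apart-sym x⊥y) (Apart-sym x⊥z)

  α≤2 : Subset n → Set
  α≤2 S = ∀ {x y z} → x ∈ S → y ∈ S → z ∈ S → IndependentTriple x y z → ⊥

  closed? : ∀ x v → Dec (v ≡ x ⊎ v ~ x)
  closed? x v = (v ≟ x) ⊎-dec (v ~? x)

  closed-neighbourhood : Fin n → Subset n
  closed-neighbourhood x = select (closed? x)

  ∈-closed⁺ : ∀ {x v} → v ≡ x ⊎ v ~ x → v ∈ closed-neighbourhood x
  ∈-closed⁺ {x} = ∈-select⁺ (closed? x)

  ∈-closed⁻ : ∀ {x v} → v ∈ closed-neighbourhood x → v ≡ x ⊎ v ~ x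
  ∈-closed⁻ {x} = ∈-select⁻ (closed? x)

  not-closed⇒apart : ∀ {x v} → ¬ (v ≡ x ⊎ v ~ x) → Apart v x
  not-closed⇒apart v∉ = v∉ ∘ inj₁ , v∉ ∘ inj₂

  ∉closed⇒apart : ∀ {x v} → v ∉ closed-neighbourhood x → Apart v x
  ∉closed⇒apart v∉ = not-closed⇒apart (v∉ ∘ ∈-closed⁺)

  apart⇒∉closed : ∀ {x v} → Apart v x → v ∉ closed-neighbourhood x
  apart⇒∉closed (v≢x , v≁x) = [ v≢x , v≁x ] ∘ ∈-closed⁻

  common-neighbourhood : List (Fin n) → Subset n
  common-neighbourhood xs = select (λ v → ListAll.all? (v ~?_) xs)

  ∈-common⁺ : ∀ {xs v} → All (v ~_) xs → v ∈ common-neighbourhood xs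
  ∈-common⁺ {xs} = ∈-select⁺ (λ v → ListAll.all? (v ~?_) xs)

  ∈-common⁻ : ∀ {xs v} → v ∈ common-neighbourhood xs → All (v ~_) xs
  ∈-common⁻ {xs} = ∈-select⁻ (λ v → ListAll.all? (v ~?_) xs)

  module _ (p3∪k1-free : G -free p3∪k1) where

    sees-two⇒sees-three : ∀ {x y z v} → IndependentTriple x y z → v ~ x → v ~ y → v ~ z
    sees-two⇒sees-three {z = z} {v} (independent x⊥y (_ , x≁z) (_ , y≁z)) v~x v~y with v ~? z
    ... | yes v~z = v~z
    ... | no v≁z  =
          ⊥-elim (no-isolated-P3 p3∪k1-free (~-sym v~x) v~y x⊥y (x≁z ∘ ~-sym) (v≁z ∘ ~-sym) (y≁z ∘ ~-sym))

    common-neighbour-sees-non-neighbour : ∀ {x y z u v} → IndependentTriple x y z →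
                                          u ~ x → u ~ y → u ~ z → v ≁ x → u ~ v
    common-neighbour-sees-non-neighbour {y = y} {z} {u} {v} T@(independent x⊥y x⊥z _) u~x u~y u~z v≁x
      with u ~? v | v ~? y | v ~? z
    ... | yes u~v | _       | _       = u~v
    ... | no u≁v  | no v≁y  | _       =
          ⊥-elim (no-isolated-P3 p3∪k1-free (~-sym u~x) u~y x⊥y v≁x (u≁v ∘ ~-sym) v≁y)
    ... | no u≁v  | _       | no v≁z  =
          ⊥-elim (no-isolated-P3 p3∪k1-free (~-sym u~x) u~z x⊥z v≁x (u≁v ∘ ~-sym) v≁z)
    ... | no _    | yes v~y | yes v~z = ⊥-elim (v≁x (sees-two⇒sees-three (rotate T) v~y v~z))

    triple-bound : ∀ {S x y z} → x ∈ S → y ∈ S → IndependentTriple x y z →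
                   WfRec _⊂_ ThreeHalvesBound S → ThreeHalvesBound S
    triple-bound {S} {x} {y} {z} x∈S y∈S T@(independent x⊥y x⊥z _) rec
      with any? (λ w → w ∈? S ×-dec w ~? x ×-dec w ~? y ×-dec w ~? z)
    ... | yes (w , w∈S , w~x , w~y , w~z) =
          join-bound (p∩q⊆p S C) complete
            (rec (x∈p∧x∉q⇒p∩q⊂p x∈S (~-irrefl ∘ ListAll.head ∘ ∈-common⁻)))
            (rec (x∈p∧x∈q⇒p─p∩q⊂p w∈S (∈-common⁺ (w~x ∷ w~y ∷ w~z ∷ []))))
      where
      C = common-neighbourhood (x ∷ y ∷ z ∷ [])
      complete : ∀ {u v} → u ∈ S ∩ C → v ∈ S ─ (S ∩ C) → u ~ v
      complete {u} {v} u∈ v∈ with ∈-common⁻ (proj₂ (x∈p∩q⁻ S C u∈)) | v ~? x | v ~? y | v ~? z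
      ... | u~x ∷ u~y ∷ u~z ∷ [] | no v≁x  | _       | _       =
            common-neighbour-sees-non-neighbour T u~x u~y u~z v≁x
      ... | u~x ∷ u~y ∷ u~z ∷ [] | _       | no v≁y  | _       =
            common-neighbour-sees-non-neighbour (rotate T) u~y u~z u~x v≁y
      ... | u~x ∷ u~y ∷ u~z ∷ [] | _       | _       | no v≁z  =
            common-neighbour-sees-non-neighbour (rotate (rotate T)) u~z u~x u~y v≁z
      ... | _                    | yes v~x | yes v~y | yes v~z =
            ⊥-elim (proj₂ (x∈p─p∩q⁻ S C v∈) (∈-common⁺ (v~x ∷ v~y ∷ v~z ∷ [])))
    ... | no no-common =
          disjoint-union-bound (p∩q⊆p S N) separated
            (rec (x∈p∧x∉q⇒p∩q⊂p y∈S (apart⇒∉closed (Apart-sym x⊥y))))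
            (rec (x∈p∧x∈q⇒p─p∩q⊂p x∈S (∈-closed⁺ (inj₁ refl))))
      where
      N = closed-neighbourhood x
      -- Every vertex of S sees at most one of x, y, z, since seeing two means seeing all three.
      separated : ∀ {u v} → u ∈ S ∩ N → v ∈ S ─ (S ∩ N) → u ≁ v
      separated {u} {v} u∈ v∈ u~v with x∈p∩q⁻ S N u∈ | x∈p─p∩q⁻ S N v∈
      ... | u∈S , u∈N | v∈S , v∉N with ∈-closed⁻ u∈N
      ...   | inj₁ refl = v∉N (∈-closed⁺ (inj₂ (~-sym u~v)))
      ...   | inj₂ u~x with v ~? z
      ...     | no v≁z  = no-isolated-P3 p3∪k1-free (~-sym u~x) u~v (Apart-sym (∉closed⇒apart v∉N))
                            (proj₂ x⊥z ∘ ~-sym) (u≁z ∘ ~-sym) (v≁z ∘ ~-sym)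
        where
        u≁z : u ≁ z
        u≁z u~z = no-common (u , u∈S , u~x , sees-two⇒sees-three (rotate (rotate T)) u~z u~x , u~z)
      ...     | yes v~z = no-isolated-P3 p3∪k1-free (~-sym u~x) u~v (Apart-sym (∉closed⇒apart v∉N))
                            (proj₂ x⊥y ∘ ~-sym) (u≁y ∘ ~-sym) (v≁y ∘ ~-sym)
        where
        u≁y : u ≁ y
        u≁y u~y = no-common (u , u∈S , u~x , u~y , sees-two⇒sees-three T u~x u~y)
        v≁y : v ≁ y
        v≁y v~y = v∉N (∈-closed⁺ (inj₂ (sees-two⇒sees-three (rotate T) v~y v~z)))

  -- Pentagons

  record Pentagon (S : Subset n) : Set where
    constructor pentagon
    field
      corners : Vec (Fin n) 5

    corner : Fin 5 → Fin n
    corner = lookup corners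

    field
      corner∈S  : ∀ i → corner i ∈ S
      side      : ∀ i → corner i ~ corner (i ⊕ 1)
      chordless : ∀ i → corner i ≁ corner (i ⊕ 2)

    far : ∀ i → corner i ≁ corner (i ⊕ 3)
    far i = subst (λ j → corner (i ⊕ 3) ≁ corner j) (⊕-5 i) (chordless (i ⊕ 3)) ∘ ~-sym

    corner-P4 : ∀ i → InducedP4 (corner i) (corner (i ⊕ 1)) (corner (i ⊕ 2)) (corner (i ⊕ 3))
    corner-P4 i = record
      { a~b = side i ; b~c = side (i ⊕ 1) ; c~d = side (i ⊕ 2)
      ; a≁c = chordless i ; a≁d = far i ; b≁d = chordless (i ⊕ 1) }

    corners-apart : ∀ i → Apart (corner i) (corner (i ⊕ 2))
    corners-apart i = ≢-by-neighbour (far i) (side (i ⊕ 2)) , chordless i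

    corner-set : Subset n
    corner-set = select (λ v → any? λ i → v ≟ corner i)

    corner∈corner-set : ∀ i → corner i ∈ corner-set
    corner∈corner-set i = ∈-select⁺ (λ v → any? λ i → v ≟ corner i) (i , refl)

    ∉corner-set : ∀ {v} → v ∉ corner-set → ∀ i → v ≢ corner i
    ∉corner-set v∉ i v≡ = v∉ (∈-select⁺ (λ v → any? λ i → v ≟ corner i) (i , v≡))

    corner-colouring : ColouringOn corner-set 3
    corner-colouring = colouring-mono classes
      (colouring-∪ (pair-colouring (chordless zero))
        (colouring-∪ (pair-colouring (chordless (zero ⊕ 1))) (single-colouring (corner (zero ⊕ 4)))))
      where
      classes : corner-set ⊆ pair (corner zero) (corner (zero ⊕ 2))
                               ∪ (pair (corner (zero ⊕ 1)) (corner (zero ⊕ 3)) ∪ Sub.⁅ corner (zero ⊕ 4) ⁆)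
      classes v∈ with ∈-select⁻ (λ v → any? λ i → v ≟ corner i) v∈
      ... | zero                       , refl = x∈p∪q⁺ (inj₁ (x∈pair _ _))
      ... | suc zero                   , refl = x∈p∪q⁺ (inj₂ (x∈p∪q⁺ (inj₁ (x∈pair _ _))))
      ... | suc (suc zero)             , refl = x∈p∪q⁺ (inj₁ (y∈pair _ _))
      ... | suc (suc (suc zero))       , refl = x∈p∪q⁺ (inj₂ (x∈p∪q⁺ (inj₁ (y∈pair _ _))))
      ... | suc (suc (suc (suc zero))) , refl = x∈p∪q⁺ (inj₂ (x∈p∪q⁺ (inj₂ (x∈⁅x⁆ _))))

  module _ (gem-free : G -free gem) {S : Subset n} (α≤2S : α≤2 S) (P : Pentagon S) where

    open Pentagon P

    corners-seen-by : Fin n → Subset 5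
    corners-seen-by v = select (λ i → v ~? corner i)

    sees : ∀ {v i} → i ∈ corners-seen-by v → v ~ corner i
    sees {v} = ∈-select⁻ (λ i → v ~? corner i)

    misses : ∀ {v i} → i ∉ corners-seen-by v → v ≁ corner i
    misses {v} i∉ v~ = i∉ (∈-select⁺ (λ i → v ~? corner i) v~)

    Window : Fin n → Fin 5 → Set
    Window v = WindowAt (corners-seen-by v)

    window : ∀ {v} → v ∈ S → v ∉ corner-set → ∃ (Window v)
    window {v} v∈S v∉ = window-pattern (corners-seen-by v) covers no-four
      where
      covers : ∀ i → i ∈ corners-seen-by v ⊎ i ⊕ 2 ∈ corners-seen-by v
      covers i with v ~? corner i | v ~? corner (i ⊕ 2)
      ... | yes v~ci | _          = inj₁ (∈-select⁺ (λ i → v ~? corner i) v~ci)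
      ... | no _     | yes v~ci+2 = inj₂ (∈-select⁺ (λ i → v ~? corner i) v~ci+2)
      ... | no v≁ci  | no v≁ci+2  = ⊥-elim (α≤2S v∈S (corner∈S i) (corner∈S (i ⊕ 2))
                                      (independent (∉corner-set v∉ i , v≁ci) (∉corner-set v∉ (i ⊕ 2) , v≁ci+2)
                                                   (corners-apart i)))
      N = corners-seen-by v
      no-four : ∀ i → ¬ (i ∈ N × i ⊕ 1 ∈ N × i ⊕ 2 ∈ N × i ⊕ 3 ∈ N)
      no-four i (s₀ , s₁ , s₂ , s₃) =
        no-dominated-P4 gem-free (corner-P4 i) (sees s₀) (sees s₁) (sees s₂) (sees s₃)

    window-not-shifted : ∀ {v a} → Window v a → Window v (a ⊕ 2) → ⊥
    window-not-shifted (_ , _ , _ , a+3∉ , _) (_ , a+3∈ , _) = a+3∉ a+3∈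

    adjacent-windows : ∀ {u v a} → Window u a → Window v (a ⊕ 2) → u ≁ v
    adjacent-windows {u} {v} {a} (s₀ , s₁ , s₂ , _) (t₂ , _ , _ , a+5∉ , a+6∉) u~v =
      no-dominated-P4 gem-free P4 (sees s₀) (sees s₁) (sees s₂) u~v
      where
      P4 : InducedP4 (corner a) (corner (a ⊕ 1)) (corner (a ⊕ 2)) v
      P4 = record
        { a~b = side a ; b~c = side (a ⊕ 1) ; c~d = ~-sym (sees t₂) ; a≁c = chordless a
        ; a≁d = misses (subst (_∉ corners-seen-by v) (⊕-5 a) a+5∉) ∘ ~-sym
        ; b≁d = misses (subst (_∉ corners-seen-by v) (cong next (⊕-5 a)) a+6∉) ∘ ~-sym }

    -- The windows of a clique lie in two consecutive positions j, j + 1, so the whole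
    -- clique sees the side from corner (j + 1) to corner (j + 2).
    extend-by-side : ∀ {w} → CliqueIn (S ─ corner-set) w → CliqueIn S (2 + w)
    extend-by-side K = clique-join side-clique (clique-mono (p─q⊆p S corner-set) K) side~K
      where
      position : ∀ k → ∃ (Window (vertex K k))
      position k = window (p─q⊆p S corner-set (vertex∈ K k)) (x∈p─q⇒x∉q S corner-set (vertex∈ K k))
      pos : Fin _ → Fin 5
      pos = proj₁ ∘ position
      taken? : ∀ a → Dec (∃ λ k → pos k ≡ a)
      taken? a = any? λ k → pos k ≟ a
      positions : Subset 5
      positions = select taken?
      no-shifted-window : ∀ {k l a} → Window (vertex K k) a → Window (vertex K l) (a ⊕ 2) → ⊥
      no-shifted-window {k} {l} wk wl with k ≟ l
      ... | yes refl = window-not-shifted wk wl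
      ... | no k≢l   = adjacent-windows wk wl (adjacent K k≢l)
      not-two-apart : ∀ k l → pos l ≢ pos k ⊕ 2
      not-two-apart k l eq =
        no-shifted-window (proj₂ (position k)) (subst (Window (vertex K l)) eq (proj₂ (position l)))
      spread : ∀ a b → a ∈ positions → b ∈ positions → b ≢ a ⊕ 2
      spread a b a∈ b∈ with ∈-select⁻ taken? a∈ | ∈-select⁻ taken? b∈
      ... | k , refl | l , refl = not-two-apart k l
      j : Fin 5
      j = proj₁ (two-consecutive-positions positions spread)
      side-clique : CliqueIn S 2
      side-clique =
        clique-join (clique-single (corner∈S (j ⊕ 1))) (clique-single (corner∈S (j ⊕ 2))) (λ _ _ → side (j ⊕ 1))
      sees-side : ∀ {v p} → Window v p → p ≡ j ⊎ p ≡ j ⊕ 1 → v ~ corner (j ⊕ 1) × v ~ corner (j ⊕ 2)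
      sees-side (_ , s₁ , s₂ , _) (inj₁ refl) = sees s₁ , sees s₂
      sees-side (s₀ , s₁ , _)     (inj₂ refl) = sees s₀ , sees s₁
      sees-common-side : ∀ k → vertex K k ~ corner (j ⊕ 1) × vertex K k ~ corner (j ⊕ 2)
      sees-common-side k = sees-side (proj₂ (position k))
        (proj₂ (two-consecutive-positions positions spread) (pos k) (∈-select⁺ taken? (k , refl)))
      side~K : ∀ e k → vertex side-clique e ~ vertex K k
      side~K zero       k = ~-sym (proj₁ (sees-common-side k))
      side~K (suc zero) k = ~-sym (proj₂ (sees-common-side k))

    pentagon-bound : WfRec _⊂_ ThreeHalvesBound S → ThreeHalvesBound S
    pentagon-bound rec = bound-by-removal corner-colouring ≤-refl extend-by-side
      (rec (p∩q≢∅⇒p─q⊂p S corner-set (corner zero , x∈p∩q⁺ (corner∈S zero , corner∈corner-set zero))))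

  closing-pentagon : ∀ {S a b c d e} → InducedP4 a b c d → e ~ a → e ~ d → e ≁ b → e ≁ c →
                     a ∈ S → b ∈ S → c ∈ S → d ∈ S → e ∈ S → Pentagon S
  closing-pentagon P e~a e~d e≁b e≁c a∈S b∈S c∈S d∈S e∈S = record
    { corners   = _ ∷ _ ∷ _ ∷ _ ∷ _ ∷ []
    ; corner∈S  = λ { zero → a∈S ; (suc zero) → b∈S ; (suc (suc zero)) → c∈S
                    ; (suc (suc (suc zero))) → d∈S ; (suc (suc (suc (suc zero)))) → e∈S }
    ; side      = λ { zero → a~b ; (suc zero) → b~c ; (suc (suc zero)) → c~d
                    ; (suc (suc (suc zero))) → ~-sym e~d ; (suc (suc (suc (suc zero)))) → e~a }
    ; chordless = λ { zero → a≁c ; (suc zero) → b≁d ; (suc (suc zero)) → e≁c ∘ ~-sym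
                    ; (suc (suc (suc zero))) → a≁d ∘ ~-sym ; (suc (suc (suc (suc zero)))) → e≁b } }
    where open InducedP4 P

  -- Induced P4s and non-adjacent pairs

  edge-neighbourhood : Subset n → Fin n → Fin n → Subset n
  edge-neighbourhood S a b = S ∩ (closed-neighbourhood a ∩ closed-neighbourhood b)

  ∈-edge⁺ : ∀ {S a b v} → v ∈ S → v ≡ a ⊎ v ~ a → v ≡ b ⊎ v ~ b → v ∈ edge-neighbourhood S a b
  ∈-edge⁺ v∈S va vb = x∈p∩q⁺ (v∈S , x∈p∩q⁺ (∈-closed⁺ va , ∈-closed⁺ vb))

  ∈-edge⁻ : ∀ {S a b v} → v ∈ edge-neighbourhood S a b → v ∈ S × (v ≡ a ⊎ v ~ a) × (v ≡ b ⊎ v ~ b)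
  ∈-edge⁻ {S} {a} {b} v∈ with x∈p∩q⁻ S _ v∈
  ... | v∈S , v∈N with x∈p∩q⁻ (closed-neighbourhood a) (closed-neighbourhood b) v∈N
  ...   | v∈Na , v∈Nb = v∈S , ∈-closed⁻ v∈Na , ∈-closed⁻ v∈Nb

  module _ (gem-free : G -free gem) {S : Subset n} (α≤2S : α≤2 S) (no-pentagon : ¬ Pentagon S) where

    -- Two non-adjacent common neighbours u, v of the edge ab see c or d; seeing both is a gem,
    -- both missing c (or d) is an independent triple, and otherwise u d c v a is a pentagon.
    common-neighbours-adjacent : ∀ {a b c d u v} → a ∈ S → c ∈ S → d ∈ S → InducedP4 a b c d →
                                 u ∈ S → v ∈ S → u ~ a → u ~ b → v ~ a → v ~ b → u ≢ v → u ~ v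
    common-neighbours-adjacent {a} {b} {c} {d} {u} {v} a∈S c∈S d∈S P u∈S v∈S u~a u~b v~a v~b u≢v
      with u ~? v | u ~? c | u ~? d | v ~? c | v ~? d
    ... | yes u~v | _       | _       | _       | _       = u~v
    ... | no _    | yes u~c | yes u~d | _       | _       =
          ⊥-elim (no-dominated-P4 gem-free P u~a u~b u~c u~d)
    ... | no _    | _       | _       | yes v~c | yes v~d =
          ⊥-elim (no-dominated-P4 gem-free P v~a v~b v~c v~d)
    ... | no u≁v  | no u≁c  | _       | no v≁c  | _       =
          ⊥-elim (α≤2S u∈S v∈S c∈S (independent (u≢v , u≁v) (apart-by-neighbour u~a (a≁c ∘ ~-sym) u≁c)
                                                 (apart-by-neighbour v~a (a≁c ∘ ~-sym) v≁c)))
      where open InducedP4 P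
    ... | no u≁v  | _       | no u≁d  | _       | no v≁d  =
          ⊥-elim (α≤2S u∈S v∈S d∈S (independent (u≢v , u≁v) (apart-by-neighbour u~a (a≁d ∘ ~-sym) u≁d)
                                                 (apart-by-neighbour v~a (a≁d ∘ ~-sym) v≁d)))
      where open InducedP4 P
    ... | no u≁v  | no u≁c  | yes u~d | yes v~c | no v≁d  =
          ⊥-elim (no-pentagon (closing-pentagon Q (~-sym u~a) (~-sym v~a) a≁d a≁c u∈S d∈S c∈S v∈S a∈S))
      where
      open InducedP4 P
      Q : InducedP4 u d c v
      Q = induced-P4 u~d (~-sym c~d) (~-sym v~c) u≁c u≁v (v≁d ∘ ~-sym)
    ... | no u≁v  | yes u~c | no u≁d  | no v≁c  | yes v~d =
          ⊥-elim (no-pentagon (closing-pentagon Q (~-sym v~a) (~-sym u~a) a≁d a≁c v∈S d∈S c∈S u∈S a∈S))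
      where
      open InducedP4 P
      Q : InducedP4 v d c u
      Q = induced-P4 v~d (~-sym c~d) (~-sym u~c) v≁c (u≁v ∘ ~-sym) (u≁d ∘ ~-sym)

    edge-neighbourhood-clique : ∀ {a b c d} → a ∈ S → c ∈ S → d ∈ S → InducedP4 a b c d →
                                PairwiseAdjacent (edge-neighbourhood S a b)
    edge-neighbourhood-clique a∈S c∈S d∈S P u∈ v∈ u≢v with ∈-edge⁻ u∈ | ∈-edge⁻ v∈
    ... | _ , inj₁ refl , _        | _ , inj₁ refl , _        = ⊥-elim (u≢v refl)
    ... | _ , inj₁ refl , _        | _ , inj₂ v~a , _         = ~-sym v~a
    ... | _ , inj₂ u~a , _         | _ , inj₁ refl , _        = u~a
    ... | _ , _ , inj₁ refl        | _ , _ , inj₁ refl        = ⊥-elim (u≢v refl)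
    ... | _ , _ , inj₁ refl        | _ , _ , inj₂ v~b         = ~-sym v~b
    ... | _ , _ , inj₂ u~b         | _ , _ , inj₁ refl        = u~b
    ... | u∈S , inj₂ u~a , inj₂ u~b | v∈S , inj₂ v~a , inj₂ v~b =
          common-neighbours-adjacent a∈S c∈S d∈S P u∈S v∈S u~a u~b v~a v~b u≢v

    -- A vertex missing one end of each edge ab, cd misses b and c (else an independent
    -- triple), hence closes the P4 into a pentagon.
    P4-cover : ∀ {a b c d v} → a ∈ S → b ∈ S → c ∈ S → d ∈ S → InducedP4 a b c d → v ∈ S →
               v ∈ edge-neighbourhood S a b ⊎ v ∈ edge-neighbourhood S d c
    P4-cover {a} {b} {c} {d} {v} a∈S b∈S c∈S d∈S P v∈S
      with closed? a v | closed? b v | closed? c v | closed? d v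
    ... | yes va | yes vb | _      | _      = inj₁ (∈-edge⁺ v∈S va vb)
    ... | _      | _      | yes vc | yes vd = inj₂ (∈-edge⁺ v∈S vd vc)
    ... | no va  | _      | no vc  | _      =
          ⊥-elim (α≤2S v∈S a∈S c∈S (independent (not-closed⇒apart va) (not-closed⇒apart vc) (InducedP4.a⊥c P)))
    ... | no va  | _      | _      | no vd  =
          ⊥-elim (α≤2S v∈S a∈S d∈S (independent (not-closed⇒apart va) (not-closed⇒apart vd) (InducedP4.a⊥d P)))
    ... | _      | no vb  | _      | no vd  =
          ⊥-elim (α≤2S v∈S b∈S d∈S (independent (not-closed⇒apart vb) (not-closed⇒apart vd) (InducedP4.b⊥d P)))
    ... | yes va | no vb  | no vc  | yes vd =
          ⊥-elim (no-pentagon (closing-pentagon P (end va a~b vb) (end vd (~-sym c~d) vc) (vb ∘ inj₂) (vc ∘ inj₂)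
                                 a∈S b∈S c∈S d∈S v∈S))
      where
      open InducedP4 P
      end : ∀ {x y} → v ≡ x ⊎ v ~ x → x ~ y → ¬ (v ≡ y ⊎ v ~ y) → v ~ x
      end (inj₁ refl) x~y vy = ⊥-elim (vy (inj₂ x~y))
      end (inj₂ v~x)  _   _  = v~x

    P4-bound : ∀ {a b c d} → a ∈ S → b ∈ S → c ∈ S → d ∈ S → InducedP4 a b c d → ThreeHalvesBound S
    P4-bound a∈S b∈S c∈S d∈S P =
      co-bipartite-bound (edge-neighbourhood-clique a∈S c∈S d∈S P)
                         (edge-neighbourhood-clique d∈S b∈S a∈S (reverse P)) S (P4-cover a∈S b∈S c∈S d∈S P)

  NoInducedP4 : Subset n → Set
  NoInducedP4 S = ∀ {a b c d} → a ∈ S → b ∈ S → c ∈ S → d ∈ S → InducedP4 a b c d → ⊥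

  module _ {S : Subset n} (α≤2S : α≤2 S) (no-P4 : NoInducedP4 S) where

    apart-pair-bound : ∀ {x y} → x ∈ S → y ∈ S → Apart x y → WfRec _⊂_ ThreeHalvesBound S → ThreeHalvesBound S
    apart-pair-bound {x} {y} x∈S y∈S (x≢y , x≁y) rec with any? (λ r → r ∈? S ×-dec r ~? x ×-dec r ~? y)
    ... | yes (r , r∈S , r~x , r~y) =
          join-bound (p∩q⊆p S C) complete (rec (x∈p∧x∉q⇒p∩q⊂p x∈S (~-irrefl ∘ ListAll.head ∘ ∈-common⁻)))
            (rec (x∈p∧x∈q⇒p─p∩q⊂p r∈S (∈-common⁺ (r~x ∷ r~y ∷ []))))
      where
      C = common-neighbourhood (x ∷ y ∷ [])
      complete : ∀ {u w} → u ∈ S ∩ C → w ∈ S ─ (S ∩ C) → u ~ w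
      complete {u} {w} u∈ w∈ with x∈p∩q⁻ S C u∈ | x∈p─p∩q⁻ S C w∈
      ... | u∈S , u∈C | w∈S , w∉C with ∈-common⁻ u∈C | u ~? w | w ~? x | w ~? y
      ...   | _              | yes u~w | _       | _       = u~w
      ...   | _              | no _    | yes w~x | yes w~y = ⊥-elim (w∉C (∈-common⁺ (w~x ∷ w~y ∷ [])))
      ...   | u~x ∷ u~y ∷ [] | no u≁w  | no w≁x  | yes w~y =
              ⊥-elim (no-P4 x∈S u∈S y∈S w∈S (induced-P4 (~-sym u~x) u~y (~-sym w~y) x≁y (w≁x ∘ ~-sym) u≁w))
      ...   | u~x ∷ u~y ∷ [] | no u≁w  | yes w~x | no w≁y  =
              ⊥-elim (no-P4 y∈S u∈S x∈S w∈S (induced-P4 (~-sym u~y) u~x (~-sym w~x) (x≁y ∘ ~-sym) (w≁y ∘ ~-sym) u≁w))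
      ...   | u~x ∷ u~y ∷ [] | no u≁w  | no w≁x  | no w≁y  =
              ⊥-elim (α≤2S w∈S x∈S y∈S (independent (≢-by-neighbour (u≁w ∘ ~-sym) (~-sym u~x) , w≁x)
                                                    (≢-by-neighbour (u≁w ∘ ~-sym) (~-sym u~y) , w≁y) (x≢y , x≁y)))
    ... | no no-common = co-bipartite-bound far-clique near-clique S cover
      where
      N = closed-neighbourhood y
      cover : ∀ {v} → v ∈ S → v ∈ S ─ N ⊎ v ∈ S ∩ N
      cover {v} v∈S with v ∈? N
      ... | yes v∈N = inj₂ (x∈p∩q⁺ (v∈S , v∈N))
      ... | no v∉N  = inj₁ (x∈p∧x∉q⇒x∈p─q v∈S v∉N)
      far-clique : PairwiseAdjacent (S ─ N)
      far-clique {u} {v} u∈ v∈ u≢v with u ~? v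
      ... | yes u~v = u~v
      ... | no u≁v  = ⊥-elim (α≤2S (p─q⊆p S N u∈) (p─q⊆p S N v∈) y∈S (independent (u≢v , u≁v)
                        (∉closed⇒apart (x∈p─q⇒x∉q S N u∈)) (∉closed⇒apart (x∈p─q⇒x∉q S N v∈))))
      apart-from-x : ∀ {u} → u ∈ S → u ~ y → Apart u x
      apart-from-x u∈S u~y = apart-by-neighbour u~y x≁y (λ u~x → no-common (_ , u∈S , u~x , u~y))
      near-clique : PairwiseAdjacent (S ∩ N)
      near-clique {u} {v} u∈ v∈ u≢v with x∈p∩q⁻ S N u∈ | x∈p∩q⁻ S N v∈
      ... | u∈S , u∈N | v∈S , v∈N with ∈-closed⁻ u∈N | ∈-closed⁻ v∈N | u ~? v
      ...   | _         | _         | yes u~v = u~v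
      ...   | inj₁ refl | inj₁ refl | no _    = ⊥-elim (u≢v refl)
      ...   | inj₁ refl | inj₂ v~y  | no u≁v  = ⊥-elim (u≁v (~-sym v~y))
      ...   | inj₂ u~y  | inj₁ refl | no u≁v  = ⊥-elim (u≁v u~y)
      ...   | inj₂ u~y  | inj₂ v~y  | no u≁v  =
              ⊥-elim (α≤2S u∈S v∈S x∈S
                        (independent (u≢v , u≁v) (apart-from-x u∈S u~y) (apart-from-x v∈S v~y)))

  clique-bound : ∀ {S} → PairwiseAdjacent S → ThreeHalvesBound S
  clique-bound {S} S-clique = co-bipartite-bound {B = Sub.⊥} S-clique (λ x∈⊥ → ⊥-elim (∉⊥ x∈⊥)) S inj₁

  apart? : ∀ x y → Dec (Apart x y)
  apart? x y = ¬? (x ≟ y) ×-dec ¬? (x ~? y)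

  triple-or-α≤2 : ∀ S → (∃ λ x → ∃ λ y → ∃ λ z → x ∈ S × y ∈ S × IndependentTriple x y z) ⊎ α≤2 S
  triple-or-α≤2 S with any? (λ x → any? λ y → any? λ z →
                         x ∈? S ×-dec y ∈? S ×-dec z ∈? S ×-dec apart? x y ×-dec apart? x z ×-dec apart? y z)
  ... | yes (x , y , z , x∈S , y∈S , _ , x⊥y , x⊥z , y⊥z) =
        inj₁ (x , y , z , x∈S , y∈S , independent x⊥y x⊥z y⊥z)
  ... | no none = inj₂ λ { x∈S y∈S z∈S (independent x⊥y x⊥z y⊥z) →
                             none (_ , _ , _ , x∈S , y∈S , z∈S , x⊥y , x⊥z , y⊥z) }

  pentagon? : ∀ S → Dec (Pentagon S)
  pentagon? S with any? (λ c₀ → any? λ c₁ → any? λ c₂ → any? λ c₃ → any? λ c₄ →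
                           is-pentagon? (c₀ ∷ c₁ ∷ c₂ ∷ c₃ ∷ c₄ ∷ []))
    where
    is-pentagon? : ∀ cs → Dec ((∀ i → lookup cs i ∈ S) × (∀ i → lookup cs i ~ lookup cs (i ⊕ 1))
                               × (∀ i → lookup cs i ≁ lookup cs (i ⊕ 2)))
    is-pentagon? cs = all? (λ i → lookup cs i ∈? S) ×-dec all? (λ i → lookup cs i ~? lookup cs (i ⊕ 1))
                        ×-dec all? (λ i → ¬? (lookup cs i ~? lookup cs (i ⊕ 2)))
  ... | yes (c₀ , c₁ , c₂ , c₃ , c₄ , ∈S , sides , chordless) =
        yes (pentagon (c₀ ∷ c₁ ∷ c₂ ∷ c₃ ∷ c₄ ∷ []) ∈S sides chordless)
  ... | no none = no λ { (pentagon (_ ∷ _ ∷ _ ∷ _ ∷ _ ∷ []) ∈S sides chordless) →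
                           none (_ , _ , _ , _ , _ , ∈S , sides , chordless) }

  P4-or-P4-free : ∀ S → (∃ λ a → ∃ λ b → ∃ λ c → ∃ λ d → a ∈ S × b ∈ S × c ∈ S × d ∈ S × InducedP4 a b c d)
                        ⊎ NoInducedP4 S
  P4-or-P4-free S with any? (λ a → any? λ b → any? λ c → any? λ d →
                      a ∈? S ×-dec b ∈? S ×-dec c ∈? S ×-dec d ∈? S ×-dec
                      a ~? b ×-dec b ~? c ×-dec c ~? d ×-dec ¬? (a ~? c) ×-dec ¬? (a ~? d) ×-dec ¬? (b ~? d))
  ... | yes (a , b , c , d , a∈S , b∈S , c∈S , d∈S , a~b , b~c , c~d , a≁c , a≁d , b≁d) =
        inj₁ (a , b , c , d , a∈S , b∈S , c∈S , d∈S , induced-P4 a~b b~c c~d a≁c a≁d b≁d)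
  ... | no none = inj₂ λ { a∈S b∈S c∈S d∈S (induced-P4 a~b b~c c~d a≁c a≁d b≁d) →
                             none (_ , _ , _ , _ , a∈S , b∈S , c∈S , d∈S , a~b , b~c , c~d , a≁c , a≁d , b≁d) }

  apart-pair-or-clique : ∀ S → (∃ λ x → ∃ λ y → x ∈ S × y ∈ S × Apart x y) ⊎ PairwiseAdjacent S
  apart-pair-or-clique S with any? (λ x → any? λ y → x ∈? S ×-dec y ∈? S ×-dec apart? x y)
  ... | yes found = inj₁ found
  ... | no none = inj₂ λ {u} {v} u∈S v∈S u≢v →
                    decidable-stable (u ~? v) λ u≁v → none (u , v , u∈S , v∈S , u≢v , u≁v)

  three-halves-bound : G -free gem → G -free p3∪k1 → ∀ S → ThreeHalvesBound S
  three-halves-bound gem-free p3∪k1-free = All.wfRec ⊂-wellFounded _ ThreeHalvesBound step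
    where
    step : ∀ S → WfRec _⊂_ ThreeHalvesBound S → ThreeHalvesBound S
    step S rec with triple-or-α≤2 S
    ... | inj₁ (_ , _ , _ , x∈S , y∈S , T) = triple-bound p3∪k1-free x∈S y∈S T rec
    ... | inj₂ α≤2S with pentagon? S
    ...   | yes P = pentagon-bound gem-free α≤2S P rec
    ...   | no no-pentagon with P4-or-P4-free S
    ...     | inj₁ (_ , _ , _ , _ , a∈S , b∈S , c∈S , d∈S , P) =
              P4-bound gem-free α≤2S no-pentagon a∈S b∈S c∈S d∈S P
    ...     | inj₂ no-P4 with apart-pair-or-clique S
    ...       | inj₁ (_ , _ , x∈S , y∈S , x⊥y) = apart-pair-bound α≤2S no-P4 x∈S y∈S x⊥y rec
    ...       | inj₂ S-clique = clique-bound S-clique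

  colouring-of-all : ∀ {k} → ColouringOn Sub.⊤ k → Colouring G k
  colouring-of-all C = record
    { col    = λ v → fromℕ< (colour< C (∈⊤ {x = v}))
    ; proper = λ u v u~v → proper C ∈⊤ ∈⊤ u~v ∘ fromℕ<-injective _ _ (colour< C ∈⊤) (colour< C ∈⊤) }

  clique-of : ∀ {S k} → CliqueIn S k → Clique G k
  clique-of K = record { vs = vertex K ; adj = λ _ _ → adjacent K }

corollary2 : (n : ℕ) (G : Graph n) → G -free gem → G -free p3∪k1 →
    (w c : ℕ) → IsCliqueNumber G w → IsChromaticNumber G c → 2 * c ≤ 3 * w
corollary2 n G gem-free p3∪k1-free w c (_ , ω-max) (_ , χ-min) = begin
  2 * c       ≤⟨ *-monoʳ-≤ 2 (χ-min colours (colouring-of-all G colouring)) ⟩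
  2 * colours ≤⟨ 2χ≤3ω ⟩
  3 * size    ≤⟨ *-monoʳ-≤ 3 (ω-max size (clique-of G clique)) ⟩
  3 * w       ∎
  where
  open ThreeHalvesBound (three-halves-bound G gem-free p3∪k1-free Sub.⊤)
  open ≤-Reasoning
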